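{- Let $2\le k\le\omega$ and let $X$ be an effective cb$_0$-space. (1) If the effective Wadge hierarchy $\{\Sigma(X,T)\}_{T\in\mathcal T_\omega(\bar k)}$ uniformly does not collapse at level $T$ and $\Sigma(X,T)$ has an element which is complete in $\Sigma(X,T)$ with respect to $\le_{eW}^X$ and is also complete in $\mathbf\Sigma(X,T)$ with respect to Wadge reducibility $\le_W^X$, then the hierarchy strongly uniformly does not collapse at level $T$. (2) If the hierarchy uniformly does not collapse and every level $\Sigma(X,T)$ has an element with the properties described in (1), then the hierarchy strongly uniformly does not collapse.
   Context: Effective cb$_0$-space: countably based $T_0$ space $X$ with a numbering $\beta$ of a base such that $\beta(i)\cap\beta(j)=\bigcup\beta(A_{ij})$, $A_{ij}$ uniformly c.e.; $\Sigma^0_1(X)$ = sets $\bigcup\beta(W)$, $W$ c.e.; $\{\Sigma^0_{1+n}(X)\}$ the effective Borel hierarchy; $\{\mathbf\Sigma^0_{1+n}(X)\}$ the boldface Borel hierarchy. For $A,B:X\to\bar k$: $A\le_{eW}^XB$ iff $A=B\circ f$ for a computable $f:X\to X$; $A\le_W^XB$ iff $A=B\circ f$ for a continuous $f:X\to X$. Complete in a class $\mathcal C$: in $\mathcal C$ and every member of $\mathcal C$ reduces to it. Trees: $\bar k=\{i<k\}$ antichain; finite normal tree = finite nonempty prefix-closed $T\subseteq\omega^*$ with $\tau(i+1)\in T\Rightarrow\tau i\in T$. For a preorder $Q$, a $Q$-tree $(T,t)$, $t:T\to Q$; $(T,t)\le_h(V,v)$ iff a $\sqsubseteq$-monotone $f:T\to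 V$ has $t(\tau)\le_Qv(f(\tau))$ for all $\tau$. $\mathcal T_0(\bar k)=\bar k$, $\mathcal T_{m+1}(\bar k)$ = $\mathcal T_m(\bar k)$-trees; $g_0(i)=(\{\varepsilon\},i)$, $g_{m+1}(T,t)=(T,g_m\circ t)$, $g_{m,p}$ compositions; $\mathcal T_\omega(\bar k)=\bigsqcup_m\mathcal T_m(\bar k)$, $T\le_hV$ iff $g_{m,p}(T)\le_hg_{n,p}(V)$, $p=\max(m,n)$. Hierarchy: for $Y\subseteq X$, $\mathcal L^n_j(Y)=\{Y\cap S:S\in\Sigma^0_{1+n+j}(X)\}$. A $T$-family in $\mathcal L^n(Y)$: for $T=i$ it is $\{Y\}$, determining the constant partition $i$; for $(T,t)\in\mathcal T_{m+1}(\bar k)$ it is $(\{U_\tau\},\{F_\tau\})_{\tau\in T}$ with $U_\tau\in\mathcal L^n_0(Y)$, $U_\varepsilon=Y$, $U_\tau\supseteq U_{\tau'}$ for $\tau\sqsubseteq\tau'$, $F_\tau$ a $t(\tau)$-family in $\mathcal L^{n+1}(\tilde U_\tau)$, $\tilde U_\tau=U_\tau\setminus\bigcup_{\tau\sqsubset\tau'\in T}U_{\tau'}$; it determines $A:Y\to\bar k$ with $A|_{\tilde U_\tau}$ determined by $F_\tau$. $\Sigma(X,T)$: $A:X\to\bar k$ determined by some $T$-family in $\mathcal L^0(X)$; $\mathbf\Sigma(X,T)$: same with boldface classes. The EWH uniformly does not collapse at level $T$ if $\Sigma(X,T)\not\subseteq\mathbf\Sigma(X,V)$ for each $V$ with $T\not\le_hV$;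 it strongly uniformly does not collapse at $T$ if $\Sigma(X,T)\not\subseteq\bigcup\{\mathbf\Sigma(X,V)\mid V\in\mathcal T_\omega(\bar k),T\not\le_hV\}$; "(strongly) uniformly does not collapse" means this at every level. -}

module Defs where

open import Level using (Lift; lift) renaming (suc to lsuc; zero to lzero)
open import Data.Nat using (ℕ; zero; suc; _≤_; _≤′_; ≤′-refl; ≤′-step; _⊔_)
open import Data.Nat.Properties using (m≤m⊔n; m≤n⊔m; ≤⇒≤′)
open import Data.Fin using (Fin)
open import Data.Vec using (Vec; []; _∷_; lookup)
open import Data.List using (List; []; _∷_; _++_; map)
open import Data.Product using (Σ; ∃; ∃-syntax; _×_; _,_; proj₁; proj₂)
open import Data.Unit using (⊤; tt)
open import Data.Empty using (⊥)
open import Relation.Nullary using (¬_)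
open import Relation.Binary.PropositionalEquality using (_≡_)
open import Function.Bundles using (_⇔_)

-- Primitive recursive functions (used to define c.e. sets via the
-- Kleene normal form: W is c.e. iff W = {n | ∃ m. p(n,m) = 0} for a
-- primitive recursive p; uniformly c.e. families carry parameters).

data PR : ℕ → Set where
  zr  : ∀ {n} → PR n
  sc  : PR 1
  pj  : ∀ {n} → Fin n → PR n
  cmp : ∀ {n m} → PR m → Vec (PR n) m → PR n
  rc  : ∀ {n} → PR n → PR (suc (suc n)) → PR (suc n)

mutual
  eval : ∀ {n} → PR n → Vec ℕ n → ℕ
  eval zr v = 0
  eval sc (x ∷ []) = suc x
  eval (pj i) v = lookup v i
  eval (cmp f gs) v = eval f (evals gs v)
  eval (rc g h) (zero ∷ v) = eval g v
  eval (rc g h) (suc x ∷ v) = eval h (eval (rc g h) (x ∷ v) ∷ x ∷ v)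

  evals : ∀ {n m} → Vec (PR n) m → Vec ℕ n → Vec ℕ m
  evals [] v = []
  evals (g ∷ gs) v = eval g v ∷ evals gs v

record EffCb0 : Set₁ where
  field
    X      : Set
    β      : ℕ → X → Set
    cover  : ∀ x → ∃[ i ] β i x
    T0     : ∀ x y → (∀ i → β i x ⇔ β i y) → x ≡ y
    -- β(i) ∩ β(j) = ⋃ β(A_ij), A_ij = {l | ∃ m. p(i,j,l,m) = 0} uniformly c.e.
    interP : PR 4
    inter  : ∀ i j x →
             (β i x × β j x) ⇔ (∃[ l ] ∃[ m ] (β l x × eval interP (l ∷ m ∷ i ∷ j ∷ []) ≡ 0))

data Card : Set where
  fin : ℕ → Card
  ω   : Card

TwoLe : Card → Set
TwoLe (fin k) = 2 ≤ k
TwoLe ω = ⊤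

K̄ : Card → Set
K̄ (fin k) = Fin k
K̄ ω = ℕ

-- Finite normal Q-trees, encoded as finite ordered rose trees;
-- a node is addressed by its word τ ∈ ω* (i-th child = letter i).

data QTree (Q : Set) : Set where
  node : Q → List (QTree Q) → QTree Q

module _ {Q : Set} where
  mutual
    inT : QTree Q → List ℕ → Set
    inT (node q ts) [] = ⊤
    inT (node q ts) (i ∷ τ) = inTs ts i τ

    inTs : List (QTree Q) → ℕ → List ℕ → Set
    inTs [] i τ = ⊥
    inTs (t ∷ ts) zero τ = inT t τ
    inTs (t ∷ ts) (suc i) τ = inTs ts i τ

  mutual
    lab : (t : QTree Q) (τ : List ℕ) → inT t τ → Q
    lab (node q ts) [] p = q
    lab (node q ts) (i ∷ τ) p = labs ts i τ p

    labs : (ts : List (QTree Q)) (i : ℕ) (τ : List ℕ) → inTs ts i τ → Q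
    labs (t ∷ ts) zero τ p = lab t τ p
    labs (t ∷ ts) (suc i) τ p = labs ts i τ p

  Pos : QTree Q → Set
  Pos t = Σ (List ℕ) (inT t)

  root : (t : QTree Q) → Pos t
  root (node q ts) = [] , tt

  labelAt : (t : QTree Q) → Pos t → Q
  labelAt t (τ , p) = lab t τ p

  mapTree : {R : Set} → (Q → R) → QTree Q → QTree R
  mapTree f (node q ts) = node (f q) (mapTrees ts)
    where
    mapTrees : List (QTree Q) → List (QTree _)
    mapTrees [] = []
    mapTrees (t ∷ ts) = mapTree f t ∷ mapTrees ts

_⊑_ : List ℕ → List ℕ → Set
τ ⊑ τ' = ∃[ ρ ] (τ ++ ρ ≡ τ')

_⊏_ : List ℕ → List ℕ → Set
τ ⊏ τ' = ∃[ i ] ∃[ ρ ] (τ ++ (i ∷ ρ) ≡ τ')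

_≤h[_]_ : {Q : Set} → QTree Q → (Q → Q → Set) → QTree Q → Set
T ≤h[ R ] V =
  Σ (Pos T → Pos V) λ f →
    (∀ p q → proj₁ p ⊑ proj₁ q → proj₁ (f p) ⊑ proj₁ (f q)) ×
    (∀ p → R (labelAt T p) (labelAt V (f p)))

module Trees (k : Card) where

  Tm : ℕ → Set
  Tm zero = K̄ k
  Tm (suc m) = QTree (Tm m)

  leq : (m : ℕ) → Tm m → Tm m → Set
  leq zero i j = i ≡ j
  leq (suc m) T V = T ≤h[ leq m ] V

  g : (m : ℕ) → Tm m → Tm (suc m)
  g zero i = node i []
  g (suc m) T = mapTree (g m) T

  gUp : ∀ {m p} → m ≤′ p → Tm m → Tm p
  gUp ≤′-refl T = T
  gUp (≤′-step {n = p} h) T = g p (gUp h T)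

  Tω : Set
  Tω = Σ ℕ Tm

  _≤hω_ : Tω → Tω → Set
  (m , T) ≤hω (n , V) =
    leq (m ⊔ n) (gUp {m} {m ⊔ n} (≤⇒≤′ (m≤m⊔n m n)) T)
                (gUp {n} {m ⊔ n} (≤⇒≤′ (m≤n⊔m m n)) V)

module Space (𝕏 : EffCb0) where
  open EffCb0 𝕏

  -- codes for uniform families (arity a) of effective Σ⁰_{1+n} sets;
  -- Σ⁰_1: ⋃β(W), W c.e.; Σ⁰_{n+2}: effective unions of differences of Σ⁰_{n+1}
  data ECode : ℕ → ℕ → Set where
    base : ∀ {a} → PR (suc (suc a)) → ECode zero a
    diff : ∀ {n a} → ECode n (suc a) → ECode n (suc a) → ECode (suc n) a

  ⟦_⟧ : ∀ {n a} → ECode n a → Vec ℕ a → X → Set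
  ⟦ base p ⟧ v x = ∃[ j ] ∃[ m ] (β j x × eval p (j ∷ m ∷ v) ≡ 0)
  ⟦ diff c d ⟧ v x = ∃[ j ] (⟦ c ⟧ (j ∷ v) x × ¬ ⟦ d ⟧ (j ∷ v) x)

  ESig : ℕ → (X → Set) → Set₁
  ESig n S = Lift (lsuc lzero) (Σ (ECode n 0) λ c → ∀ x → S x ⇔ ⟦ c ⟧ [] x)

  BSig : ℕ → (X → Set) → Set₁
  BSig zero S = Σ (ℕ → Set) λ W → ∀ x → S x ⇔ (∃[ j ] (W j × β j x))
  BSig (suc n) S =
    Σ (ℕ → X → Set) λ A → Σ (ℕ → X → Set) λ B →
      (∀ i → BSig n (A i)) × (∀ i → BSig n (B i)) ×
      (∀ x → S x ⇔ (∃[ i ] (A i x × ¬ B i x)))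

  Continuous : (X → X) → Set₁
  Continuous f = ∀ i → BSig zero (λ x → β i (f x))

  -- f⁻¹(β(i)) = ⋃β(W_i) with (W_i) uniformly c.e.
  Computable : (X → X) → Set
  Computable f = Σ (PR 3) λ p → ∀ i x → β i (f x) ⇔ ⟦ base p ⟧ (i ∷ []) x

  module _ (k : Card) where
    open Trees k

    _≤eW_ : (X → K̄ k) → (X → K̄ k) → Set
    A ≤eW B = Σ (X → X) λ f → Computable f × (∀ x → A x ≡ B (f x))

    _≤W_ : (X → K̄ k) → (X → K̄ k) → Set₁
    A ≤W B = Σ (X → X) λ f → Continuous f × (∀ x → A x ≡ B (f x))

    -- "A|Y is determined by some T-family in 𝓛ⁿ(Y)" (relative to a
    -- hierarchy Cls, where Cls n = Σ⁰_{1+n}(X))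
    Det : (ℕ → (X → Set) → Set₁) → (n m : ℕ) → (X → Set) → Tm m → (X → K̄ k) → Set₁
    Det Cls n zero Y i A = Lift (lsuc lzero) (∀ x → Y x → A x ≡ i)
    Det Cls n (suc m) Y T A =
      Σ (Pos T → X → Set) λ S →
        let U : Pos T → X → Set
            U p x = Y x × S p x
            Ũ : Pos T → X → Set
            Ũ p x = U p x × ¬ (Σ (Pos T) λ q → (proj₁ p ⊏ proj₁ q) × U q x)
        in (∀ p → Cls n (S p)) ×
           (∀ x → Y x → S (root T) x) ×
           (∀ p q → proj₁ p ⊑ proj₁ q → ∀ x → U q x → U p x) ×
           (∀ p → Det Cls (suc n) m (Ũ p) (labelAt T p) A)

    Σ[_] : Tω → (X → K̄ k) → Set₁
    Σ[ (m , T) ] A = Det ESig 0 m (λ _ → ⊤) T A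

    𝚺[_] : Tω → (X → K̄ k) → Set₁
    𝚺[ (m , T) ] A = Det BSig 0 m (λ _ → ⊤) T A

    UniformlyNonCollapseAt : Tω → Set₁
    UniformlyNonCollapseAt T =
      ∀ V → ¬ (T ≤hω V) → Σ (X → K̄ k) λ A → Σ[ T ] A × ¬ 𝚺[ V ] A

    StronglyUniformlyNonCollapseAt : Tω → Set₁
    StronglyUniformlyNonCollapseAt T =
      Σ (X → K̄ k) λ A → Σ[ T ] A × (∀ V → ¬ (T ≤hω V) → ¬ 𝚺[ V ] A)

    HasBiComplete : Tω → Set₁
    HasBiComplete T =
      Σ (X → K̄ k) λ A →
        Σ[ T ] A × (∀ B → Σ[ T ] B → B ≤eW A) ×
        𝚺[ T ] A × (∀ B → 𝚺[ T ] B → B ≤W A)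

-- Let A be ≤eW-complete in Σ(X,T). If A lay in 𝚺(X,V) for some V with T ≰h V, then
-- so would every B ∈ Σ(X,T): computable maps are continuous and the
-- boldface levels 𝚺(X,V) are closed under continuous preimages. Uniform non-collapse
-- provides a B ∈ Σ(X,T) outside 𝚺(X,V), so the single complete A witnesses strong
-- non-collapse.
{-# OPTIONS --safe #-}
module Submission where

open import Defs
open import Level using (lift)
open import Data.Nat using (zero; suc)
open import Data.Product using (_×_; ∃-syntax; _,_; proj₁; proj₂)
open import Data.Vec using ([]; _∷_)
open import Function using (_∘_)
open import Function.Bundles using (mk⇔; Equivalence)
open import Relation.Binary.PropositionalEquality using (_≡_; trans)

open Equivalence using (to; from)

module _ (𝕏 : EffCb0) where
  open EffCb0 𝕏
  open Space 𝕏

  computable⇒continuous : ∀ {f} → Computable f → Continuous f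
  computable⇒continuous (p , h) i =
    (λ j → ∃[ m ] (eval p (j ∷ m ∷ i ∷ []) ≡ 0)) ,
    λ x → mk⇔ (λ b → let (j , m , bj , e) = to (h i x) b in j , (m , e) , bj)
              (λ { (j , (m , e) , bj) → from (h i x) (j , m , bj , e) })

  BSig-preimage : ∀ {f} → Continuous f → ∀ n {S} → BSig n S → BSig n (S ∘ f)
  BSig-preimage {f} c zero (W , h) =
    (λ l → ∃[ j ] (W j × proj₁ (c j) l)) ,
    λ x → mk⇔
      (λ s → let (j , wj , bj) = to (h (f x)) s
                 (l , wl , bl) = to (proj₂ (c j) x) bj
             in l , (j , wj , wl) , bl)
      (λ { (l , (j , wj , wl) , bl) →
             from (h (f x)) (j , wj , from (proj₂ (c j) x) (l , wl , bl)) })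
  BSig-preimage {f} c (suc n) (A , B , hA , hB , h) =
    (λ i → A i ∘ f) , (λ i → B i ∘ f) ,
    (λ i → BSig-preimage c n (hA i)) , (λ i → BSig-preimage c n (hB i)) ,
    h ∘ f

  module _ (k : Card) where
    open Trees k

    Det-preimage : ∀ {f} → Continuous f → ∀ n m {Y} {T : Tm m} {A B} →
                   (∀ x → B x ≡ A (f x)) →
                   Det k BSig n m Y T A → Det k BSig n m (Y ∘ f) T B
    Det-preimage {f} c n zero e (lift d) = lift (λ x y → trans (e x) (d (f x) y))
    Det-preimage {f} c n (suc m) {T = T} e (S , hS , hr , hm , hd) =
      (λ p → S p ∘ f) ,
      (λ p → BSig-preimage c n (hS p)) ,
      hr ∘ f ,
      (λ p q pq → hm p q pq ∘ f) ,
      (λ p → Det-preimage c (suc n) m e (hd p))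

    ≤eW⇒≤W : ∀ {A B} → _≤eW_ k A B → _≤W_ k A B
    ≤eW⇒≤W (f , cf , e) = f , computable⇒continuous cf , e

    𝚺-downward-closed : ∀ V {A B} → _≤W_ k B A → 𝚺[_] k V A → 𝚺[_] k V B
    𝚺-downward-closed (m , V) (f , cf , e) = Det-preimage cf 0 m e

    stronglyNonCollapseAt : ∀ T → UniformlyNonCollapseAt k T → HasBiComplete k T →
                            StronglyUniformlyNonCollapseAt k T
    stronglyNonCollapseAt T nonCollapse (A , ΣA , complete , _) =
      A , ΣA , λ V T≰V 𝚺A →
        let (B , ΣB , B∉𝚺) = nonCollapse V T≰V
        in B∉𝚺 (𝚺-downward-closed V (≤eW⇒≤W {B} {A} (complete B ΣB)) 𝚺A)

proposition4p2 : (k : Card) → TwoLe k → (𝕏 : EffCb0) →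
    ((T : Trees.Tω k) →
       Space.UniformlyNonCollapseAt 𝕏 k T → Space.HasBiComplete 𝕏 k T →
       Space.StronglyUniformlyNonCollapseAt 𝕏 k T)
    ×
    (((T : Trees.Tω k) → Space.UniformlyNonCollapseAt 𝕏 k T) →
     ((T : Trees.Tω k) → Space.HasBiComplete 𝕏 k T) →
     (T : Trees.Tω k) → Space.StronglyUniformlyNonCollapseAt 𝕏 k T)
proposition4p2 k _ 𝕏 =
  stronglyNonCollapseAt 𝕏 k ,
  λ nonCollapse complete T → stronglyNonCollapseAt 𝕏 k T (nonCollapse T) (complete T)
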